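{- Let $G$ be a graph with at least two vertices, let $F$ be an edition set for $G$ with $|F| = 1$, and let $G' = G+F$. Then (1) $|\mathcal{U}(G'_{\mathrm{Q}})| \leq |\mathcal{U}(G_{\mathrm{Q}})| + 4$; (2) $|\mathcal{P}(G'_{\mathrm{Q}})| \leq |\mathcal{P}(G_{\mathrm{Q}})| + 2$; (3) $|\mathcal{S}(G'_{\mathrm{Q}})| \leq |\mathcal{S}(G_{\mathrm{Q}})| + 2$; (4) $|V(G'_{\mathrm{Q}})| \leq |V(G_{\mathrm{Q}})| + 2$.
   Context: All graphs are finite, simple and undirected. An edition set $F$ for $G$ is a set of unordered pairs of distinct vertices of $G$, no pair occurring twice, each marked $-$ (an edge of $G$ to be deleted) or $+$ (a non-edge of $G$ to be added); $G+F$ is the resulting graph. Modular decomposition: a module of $G$ is a set $M \subseteq V(G)$ such that every vertex outside $M$ is adjacent to all or to none of the vertices of $M$. A module is strong if for every module $M'$ either $M \cap M' = \emptyset$ or one of $M, M'$ contains the other. The modular decomposition tree $T_G$ has the strong modules of $G$ as nodes, $V(G)$ as root and the singletons $\{v\}$ as leaves; the children of an internal node $M$ are the maximal strong modules properly contained in $M$. An internal node $M$ is labelled P if $G[M]$ is disconnected, S if the complement of $G[M]$ is disconnected, and N otherwise. Q-partition and Q-quotient graph: the Q-partition $\Pi$ of $V(G)$ is defined by: if $\{x\}$ is a leaf child of a node labelled N, then $\{x\}$ is a part of $\Pi$; if $\{x_1\},\dots,\{x_j\}$ are all the leaf children of a node labelled P or S, then $\{x_1,\dots,x_j\}$ is a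 part of $\Pi$. Each part is a module, so between two distinct parts either all or no edges are present. The Q-quotient graph $G_{\mathrm{Q}}$ has the parts of $\Pi$ as vertices, two parts adjacent iff there are edges of $G$ between them. A vertex of $G_{\mathrm{Q}}$ is a U-vertex if its part is a singleton, a P-vertex if its part (of size at least two) consists of the leaf children of a node labelled P, and an S-vertex if its part (of size at least two) consists of the leaf children of a node labelled S. For a Q-quotient graph $H$, $\mathcal{U}(H)$, $\mathcal{P}(H)$, $\mathcal{S}(H)$ denote its sets of U-vertices, P-vertices and S-vertices. -}

module Defs where

open import Data.Bool using (Bool; true; false; _∧_; _∨_; not; _xor_; if_then_else_)
open import Data.Bool.Properties using (∨-comm)
open import Data.Nat using (ℕ; zero; suc; _≡ᵇ_; _≤ᵇ_)
open import Data.Fin using (Fin)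
open import Data.Fin.Properties using (_≟_)
open import Data.Fin.Subset using (Subset; ⁅_⁆; ∣_∣)
open import Data.Vec using (Vec; []; _∷_; lookup; tabulate)
open import Data.Vec.Properties using (≡-dec)
import Data.Bool.Properties as BoolP
open import Data.List using (List; []; _∷_; map; _++_; filter; length; allFin)
open import Data.Bool.ListAction using (all; any)
open import Data.Product using (_×_; _,_)
open import Relation.Nullary using (¬_; Dec; yes; no)
open import Relation.Nullary.Decidable using (⌊_⌋)
open import Relation.Binary.PropositionalEquality using (_≡_; refl; _≢_; sym; trans)

record Graph (n : ℕ) : Set where
  field
    adj    : Fin n → Fin n → Bool
    adj-sym    : ∀ x y → adj x y ≡ adj y x
    adj-irrefl : ∀ x → adj x x ≡ false
open Graph public

-- Editing one pair {u,v}, u ≠ v:  G + F  for the edition set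
-- F = {uv} (marked − if uv ∈ E(G), + otherwise).  The adjacency of the
-- pair {u,v} is flipped, all other pairs are unchanged.

isPair : ∀ {n} → Fin n → Fin n → Fin n → Fin n → Bool
isPair u v x y = (⌊ x ≟ u ⌋ ∧ ⌊ y ≟ v ⌋) ∨ (⌊ x ≟ v ⌋ ∧ ⌊ y ≟ u ⌋)

private
  isPair-sym : ∀ {n} (u v x y : Fin n) → isPair u v x y ≡ isPair u v y x
  isPair-sym u v x y with x ≟ u | y ≟ v | x ≟ v | y ≟ u
  ... | yes _ | yes _ | yes _ | yes _ = refl
  ... | yes _ | yes _ | yes _ | no  _ = refl
  ... | yes _ | yes _ | no  _ | yes _ = refl
  ... | yes _ | yes _ | no  _ | no  _ = refl
  ... | yes _ | no  _ | yes _ | yes _ = refl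
  ... | yes _ | no  _ | yes _ | no  _ = refl
  ... | yes _ | no  _ | no  _ | yes _ = refl
  ... | yes _ | no  _ | no  _ | no  _ = refl
  ... | no  _ | yes _ | yes _ | yes _ = refl
  ... | no  _ | yes _ | yes _ | no  _ = refl
  ... | no  _ | yes _ | no  _ | yes _ = refl
  ... | no  _ | yes _ | no  _ | no  _ = refl
  ... | no  _ | no  _ | yes _ | yes _ = refl
  ... | no  _ | no  _ | yes _ | no  _ = refl
  ... | no  _ | no  _ | no  _ | yes _ = refl
  ... | no  _ | no  _ | no  _ | no  _ = refl

  isPair-irr : ∀ {n} (u v x : Fin n) → u ≢ v → isPair u v x x ≡ false
  isPair-irr u v x u≢v with x ≟ u | x ≟ v
  ... | yes p | yes q = Relation.Nullary.contradiction (trans (sym p) q) u≢v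
    where import Relation.Nullary
  ... | yes _ | no  _ = refl
  ... | no  _ | yes _ = refl
  ... | no  _ | no  _ = refl

  xor-cong : ∀ {a b c d : Bool} → a ≡ b → c ≡ d → (a xor c) ≡ (b xor d)
  xor-cong refl refl = refl

  xor-false : ∀ {a b : Bool} → a ≡ false → b ≡ false → (a xor b) ≡ false
  xor-false refl refl = refl

edit1 : ∀ {n} → Graph n → (u v : Fin n) → u ≢ v → Graph n
edit1 G u v u≢v = record
  { adj    = λ x y → isPair u v x y xor adj G x y
  ; adj-sym    = λ x y → xor-cong (isPair-sym u v x y) (adj-sym G x y)
  ; adj-irrefl = λ x → xor-false (isPair-irr u v x u≢v) (adj-irrefl G x)
  }

allSubsets : (n : ℕ) → List (Subset n)
allSubsets zero    = [] ∷ []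
allSubsets (suc n) = map (true ∷_) (allSubsets n) ++ map (false ∷_) (allSubsets n)

_∋_ : ∀ {n} → Subset n → Fin n → Bool
M ∋ x = lookup M x

vtx : (n : ℕ) → List (Fin n)
vtx n = allFin n

_==_ : ∀ {n} → Subset n → Subset n → Bool
A == B = ⌊ ≡-dec BoolP._≟_ A B ⌋

_⊆ᵇ_ : ∀ {n} → Subset n → Subset n → Bool
_⊆ᵇ_ {n} A B = all (λ x → not (A ∋ x) ∨ (B ∋ x)) (vtx n)

disjointᵇ : ∀ {n} → Subset n → Subset n → Bool
disjointᵇ {n} A B = all (λ x → not (A ∋ x ∧ B ∋ x)) (vtx n)

nonemptyᵇ : ∀ {n} → Subset n → Bool
nonemptyᵇ {n} A = any (λ x → A ∋ x) (vtx n)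

_⊂ᵇ_ : ∀ {n} → Subset n → Subset n → Bool
A ⊂ᵇ B = (A ⊆ᵇ B) ∧ not (A == B)

isModule : ∀ {n} → Graph n → Subset n → Bool
isModule {n} G M =
  all (λ x → (M ∋ x) ∨'
         all (λ a → all (λ b → not (M ∋ a ∧ M ∋ b) ∨
                                 ⌊ BoolP._≟_ (adj G x a) (adj G x b) ⌋) (vtx n)) (vtx n))
      (vtx n)
  where
    _∨'_ : Bool → Bool → Bool
    _∨'_ = _∨_

isStrong : ∀ {n} → Graph n → Subset n → Bool
isStrong {n} G M =
  nonemptyᵇ M ∧ isModule G M ∧
  all (λ M' → not (isModule G M') ∨
               (disjointᵇ M M' ∨ (M ⊆ᵇ M' ∨ M' ⊆ᵇ M)))
      (allSubsets n)

-- internal nodes of the modular decomposition tree T_G: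
-- strong modules that are not singletons
isInternal : ∀ {n} → Graph n → Subset n → Bool
isInternal G M = isStrong G M ∧ not (1 ≡ᵇ ∣ M ∣)

-- {x} is a child of the node M: {x} is a maximal strong module properly
-- contained in M (singletons are always strong modules)
isLeafChild : ∀ {n} → Graph n → Subset n → Fin n → Bool
isLeafChild {n} G M x =
  (⁅ x ⁆ ⊂ᵇ M) ∧
  all (λ M' → not (isStrong G M' ∧ (⁅ x ⁆ ⊂ᵇ M') ∧ (M' ⊂ᵇ M))) (allSubsets n)

leafChildren : ∀ {n} → Graph n → Subset n → Subset n
leafChildren G M = tabulate (isLeafChild G M)

-- G[M] is disconnected: M splits into two nonempty parts A, M \ A with
-- no edge of G between them
disconnectedIn : ∀ {n} → (Fin n → Fin n → Bool) → Subset n → Bool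
disconnectedIn {n} E M =
  any (λ A → (A ⊆ᵇ M) ∧ nonemptyᵇ A ∧ not (A == M) ∧
             all (λ a → all (λ b → not (A ∋ a ∧ M ∋ b ∧ not (A ∋ b)) ∨ not (E a b))
                            (vtx n)) (vtx n))
      (allSubsets n)

complementAdj : ∀ {n} → Graph n → Fin n → Fin n → Bool
complementAdj G x y = not ⌊ x ≟ y ⌋ ∧ not (adj G x y)

labelP : ∀ {n} → Graph n → Subset n → Bool
labelP G M = disconnectedIn (adj G) M

labelS : ∀ {n} → Graph n → Subset n → Bool
labelS G M = disconnectedIn (complementAdj G) M

labelN : ∀ {n} → Graph n → Subset n → Bool
labelN G M = not (labelP G M) ∧ not (labelS G M)

-- The Q-partition: A ⊆ V(G) is a part iff
--  * A = {x} with {x} a leaf child of an internal node labelled N, or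
--  * A is the (nonempty) set of all leaf children of an internal node
--    labelled P or S.

isQPart : ∀ {n} → Graph n → Subset n → Bool
isQPart {n} G A =
  any (λ M → isInternal G M ∧
             ((labelN G M ∧ any (λ x → isLeafChild G M x ∧ (A == ⁅ x ⁆)) (vtx n)) ∨
              ((labelP G M ∨ labelS G M) ∧ nonemptyᵇ A ∧ (A == leafChildren G M))))
      (allSubsets n)

isUVertex : ∀ {n} → Graph n → Subset n → Bool
isUVertex G A = isQPart G A ∧ (1 ≡ᵇ ∣ A ∣)

isPVertex : ∀ {n} → Graph n → Subset n → Bool
isPVertex {n} G A =
  (2 ≤ᵇ ∣ A ∣) ∧ nonemptyᵇ A ∧
  any (λ M → isInternal G M ∧ labelP G M ∧ (A == leafChildren G M)) (allSubsets n)

isSVertex : ∀ {n} → Graph n → Subset n → Bool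
isSVertex {n} G A =
  (2 ≤ᵇ ∣ A ∣) ∧ nonemptyᵇ A ∧
  any (λ M → isInternal G M ∧ labelS G M ∧ (A == leafChildren G M)) (allSubsets n)

-- number of subsets of V(G) satisfying a boolean predicate
-- (allSubsets n lists every subset exactly once)
countSubsets : (n : ℕ) → (Subset n → Bool) → ℕ
countSubsets n p = length (filter (λ A → p A BoolP.≟ true) (allSubsets n))

numU numP numS numV : ∀ {n} → Graph n → ℕ
numU {n} G = countSubsets n (isUVertex G)
numP {n} G = countSubsets n (isPVertex G)
numS {n} G = countSubsets n (isSVertex G)
numV {n} G = countSubsets n (isQPart G)

-- The parts of the Q-partition are exactly the twin classes of G, where x and y are twins when
-- they have the same neighbours outside {x, y}. Leaf children of a P-node have no neighbour in
-- the node and those of an S-node are adjacent to all of it, so they are pairwise twins; twins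
-- of a leaf child are leaf children of the same node; and a leaf child of an N-node has no twin,
-- since the module formed by a pair of twins would grow into a strong module strictly between
-- the leaf and the node. U-, P- and S-vertices are the classes of size one, of non-adjacent twins
-- and of adjacent twins. Editing the pair uv does not change which vertices other than u and v
-- are twins, so adding its G-twins turns each class of G + uv avoiding u and v into a distinct
-- class of G of the same kind; at most two classes contain u or v, and a singleton class that
-- is no singleton in G holds a G-twin of u or of v.

module Submission where

open import Defs
open import Data.Bool using (Bool; true; false; _∧_; _∨_; not)
import Data.Bool.Properties as Bool
open import Data.Bool.ListAction using (all; any)
open import Data.Empty using (⊥; ⊥-elim)
open import Data.Fin using (Fin; zero; suc)
open import Data.Fin.Properties using (_≟_; all?; any?)
open import Data.Fin.Subset using (Subset; ⁅_⁆; ∣_∣; _∈_; _∉_; _⊆_; _⊂_; _⊃_; _∪_; _∩_; ∁; ⊤; Nonempty)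
open import Data.Fin.Subset.Induction using (Acc; acc; ⊂-wellFounded; ⊃-wellFounded)
open import Data.Fin.Subset.Properties using (_∈?_; ⊆-antisym; ⊂-⊆-trans; ⊂-trans; p⊂q⇒∣p∣<∣q∣; ∣⁅x⁆∣≡1; x∈⁅x⁆; x∈⁅y⁆⇒x≡y; x≢y⇒x∉⁅y⁆; x∉⁅y⁆⇒x≢y; ∈⊤; x∈p∪q⁺; x∈p∪q⁻; x∈p∩q⁺; x∈p∩q⁻; p∩q⊆p; x∈p⇒x∉∁p; x∉p⇒x∈∁p; x∈∁p⇒x∉p)
open import Data.List using (List; []; _∷_; map; filter; length)
import Data.List.Membership.Propositional as List
open import Data.List.Membership.Propositional.Properties using (∈-allFin; ∈-map⁺; ∈-map⁻; ∈-++⁺ˡ; ∈-++⁺ʳ; ∈-filter⁺; ∈-filter⁻)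
open import Data.List.Properties using (filter-all; filter-none; length-map)
open import Data.List.Relation.Unary.All as All using ([]; _∷_)
import Data.List.Relation.Unary.All.Properties as All⁺
open import Data.List.Relation.Unary.AllPairs using ([]; _∷_)
open import Data.List.Relation.Unary.Any using (here; there)
open import Data.List.Relation.Unary.Unique.Propositional using (Unique)
import Data.List.Relation.Unary.Unique.Propositional.Properties as Unique
open import Data.Nat using (ℕ; zero; suc; _≤_; _+_; z≤n; s≤s; _≡ᵇ_; _≤ᵇ_)
open import Data.Nat.Properties using (≤-refl; ≤-reflexive; ≤-trans; +-suc; +-mono-≤; +-monoʳ-≤; +-comm; +-assoc)
open import Data.Product using (_×_; _,_; proj₁; proj₂; ∃-syntax)
open import Data.Sum using (_⊎_; inj₁; inj₂; [_,_]′)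
open import Data.Vec using ([]; _∷_; tabulate)
open import Data.Vec.Properties using (≡-dec; ∷-injectiveʳ; []=⇒lookup; lookup⇒[]=; lookup∘tabulate)
open import Function using (_∘_; case_of_)
open import Relation.Binary.Definitions using (DecidableEquality)
open import Relation.Binary.PropositionalEquality using (_≡_; refl; _≢_; sym; trans; cong; cong₂; subst; module ≡-Reasoning)
open import Relation.Nullary using (¬_; Dec; yes; no; ¬?; contradiction)
open import Relation.Nullary.Decidable using (⌊_⌋; decidable-stable; _×-dec_; _→-dec_)

private
  variable
    n : ℕ

∧-true : ∀ {a b} → a ∧ b ≡ true → a ≡ true × b ≡ true
∧-true {true} b = refl , b

∧-intro : ∀ {a b} → a ≡ true → b ≡ true → a ∧ b ≡ true
∧-intro refl b = b

∧-false : ∀ {a b} → a ≡ true → a ∧ b ≡ false → b ≡ false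
∧-false refl b = b

∨-true : ∀ {a b} → a ∨ b ≡ true → a ≡ true ⊎ b ≡ true
∨-true {true}  _ = inj₁ refl
∨-true {false} b = inj₂ b

∨-introˡ : ∀ {a b} → a ≡ true → a ∨ b ≡ true
∨-introˡ refl = refl

∨-introʳ : ∀ {a b} → b ≡ true → a ∨ b ≡ true
∨-introʳ {a} refl = Bool.∨-zeroʳ a

not-true : ∀ {a} → not a ≡ true → a ≡ false
not-true {false} _ = refl

not-intro : ∀ {a} → a ≡ false → not a ≡ true
not-intro refl = refl

implies-true : ∀ {a b} → not a ∨ b ≡ true → a ≡ true → b ≡ true
implies-true p refl = p

implies-intro : ∀ {a b} → (a ≡ true → b ≡ true) → not a ∨ b ≡ true
implies-intro {false} _ = refl
implies-intro {true}  f = f refl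

true≢false : ∀ {a} → a ≡ true → a ≢ false
true≢false refl ()

does-true : ∀ {P : Set} (P? : Dec P) → ⌊ P? ⌋ ≡ true → P
does-true (yes p) _ = p

does-intro : ∀ {P : Set} (P? : Dec P) → P → ⌊ P? ⌋ ≡ true
does-intro (yes _) _ = refl
does-intro (no ¬p) p = contradiction p ¬p

does-false : ∀ {P : Set} (P? : Dec P) → ¬ P → ⌊ P? ⌋ ≡ false
does-false (yes p) ¬p = contradiction p ¬p
does-false (no _)  _  = refl

2≤⇒1≢ᵇ : ∀ {k} → 2 ≤ k → (1 ≡ᵇ k) ≡ false
2≤⇒1≢ᵇ (s≤s (s≤s _)) = refl

2≤⇒2≤ᵇ : ∀ {k} → 2 ≤ k → (2 ≤ᵇ k) ≡ true
2≤⇒2≤ᵇ (s≤s (s≤s _)) = refl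

2≤ᵇ⇒2≤ : ∀ k → (2 ≤ᵇ k) ≡ true → 2 ≤ k
2≤ᵇ⇒2≤ (suc (suc k)) _ = s≤s (s≤s z≤n)

module Enumeration {A : Set} {xs : List A} (complete : ∀ x → x List.∈ xs) where

  private
    all-∈ : ∀ {p : A → Bool} {ys} → all p ys ≡ true → ∀ {x} → x List.∈ ys → p x ≡ true
    all-∈ {p} {y ∷ _} q (here refl) = proj₁ (∧-true {p y} q)
    all-∈ {p} {y ∷ _} q (there x∈) = all-∈ (proj₂ (∧-true {p y} q)) x∈

    any-∈ : ∀ {p : A → Bool} {ys x} → x List.∈ ys → p x ≡ true → any p ys ≡ true
    any-∈ (here refl) q = ∨-introˡ q
    any-∈ {p} {y ∷ _} (there x∈) q = ∨-introʳ {p y} (any-∈ x∈ q)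

  all-true : ∀ {p : A → Bool} → all p xs ≡ true → ∀ x → p x ≡ true
  all-true q x = all-∈ q (complete x)

  all-intro : ∀ {p : A → Bool} → (∀ x → p x ≡ true) → all p xs ≡ true
  all-intro {p} h = go xs
    where
    go : ∀ ys → all p ys ≡ true
    go []       = refl
    go (y ∷ ys) = ∧-intro (h y) (go ys)

  all-false : ∀ {p : A → Bool} → all p xs ≡ false → ∃[ x ] p x ≡ false
  all-false {p} = go xs
    where
    go : ∀ ys → all p ys ≡ false → ∃[ x ] p x ≡ false
    go (y ∷ ys) q with p y in eq
    ... | false = y , eq
    ... | true  = go ys q

  any-true : ∀ {p : A → Bool} → any p xs ≡ true → ∃[ x ] p x ≡ true
  any-true {p} = go xs
    where
    go : ∀ ys → any p ys ≡ true → ∃[ x ] p x ≡ true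
    go (y ∷ ys) q with p y in eq
    ... | true  = y , eq
    ... | false = go ys q

  any-intro : ∀ {p : A → Bool} x → p x ≡ true → any p xs ≡ true
  any-intro x = any-∈ (complete x)

allSubsets-complete : (A : Subset n) → A List.∈ allSubsets n
allSubsets-complete []          = here refl
allSubsets-complete (true ∷ A)  = ∈-++⁺ˡ (∈-map⁺ (true ∷_) (allSubsets-complete A))
allSubsets-complete {suc n} (false ∷ A) =
  ∈-++⁺ʳ (map (true ∷_) (allSubsets n)) (∈-map⁺ (false ∷_) (allSubsets-complete A))

allSubsets-unique : ∀ n → Unique (allSubsets n)
allSubsets-unique zero    = [] ∷ []
allSubsets-unique (suc n) =
  Unique.++⁺ (Unique.map⁺ ∷-injectiveʳ (allSubsets-unique n))
             (Unique.map⁺ ∷-injectiveʳ (allSubsets-unique n)) heads-differ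
  where
  heads-differ : ∀ {A} → ¬ (A List.∈ map (true ∷_) (allSubsets n) × A List.∈ map (false ∷_) (allSubsets n))
  heads-differ (A∈₁ , A∈₂) with ∈-map⁻ (true ∷_) A∈₁ | ∈-map⁻ (false ∷_) A∈₂
  ... | _ , _ , refl | _ , _ , ()

module Vertices {n} = Enumeration (∈-allFin {n})
module Subsets {n} = Enumeration (allSubsets-complete {n})

∋⇒∈ : ∀ {A : Subset n} {x} → A ∋ x ≡ true → x ∈ A
∋⇒∈ {A = A} {x} = lookup⇒[]= x A

∈⇒∋ : ∀ {A : Subset n} {x} → x ∈ A → A ∋ x ≡ true
∈⇒∋ = []=⇒lookup

∉⇒∋ : ∀ {A : Subset n} {x} → x ∉ A → A ∋ x ≡ false
∉⇒∋ x∉A = Bool.¬-not (x∉A ∘ ∋⇒∈)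

∋⇒∉ : ∀ {A : Subset n} {x} → A ∋ x ≡ false → x ∉ A
∋⇒∉ A∌x x∈A = true≢false (∈⇒∋ x∈A) A∌x

module _ {A B : Subset n} where

  ⊆ᵇ⇒⊆ : (A ⊆ᵇ B) ≡ true → A ⊆ B
  ⊆ᵇ⇒⊆ p x∈A = ∋⇒∈ (implies-true (Vertices.all-true {n} p _) (∈⇒∋ x∈A))

  ⊆⇒⊆ᵇ : A ⊆ B → (A ⊆ᵇ B) ≡ true
  ⊆⇒⊆ᵇ A⊆B = Vertices.all-intro {n} λ x → implies-intro (∈⇒∋ ∘ A⊆B ∘ ∋⇒∈)

  ==⇒≡ : (A == B) ≡ true → A ≡ B
  ==⇒≡ = does-true (≡-dec Bool._≟_ A B)

  ≡⇒== : A ≡ B → (A == B) ≡ true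
  ≡⇒== = does-intro (≡-dec Bool._≟_ A B)

  ≢⇒== : A ≢ B → (A == B) ≡ false
  ≢⇒== = does-false (≡-dec Bool._≟_ A B)

  disjointᵇ⇒∉ : disjointᵇ A B ≡ true → ∀ {x} → x ∈ A → x ∉ B
  disjointᵇ⇒∉ p {x} x∈A x∈B =
    true≢false (∧-intro (∈⇒∋ x∈A) (∈⇒∋ x∈B)) (not-true (Vertices.all-true {n} p x))

  disjointᵇ-false : disjointᵇ A B ≡ false → ∃[ x ] (x ∈ A × x ∈ B)
  disjointᵇ-false p with Vertices.all-false {n} p
  ... | x , q with ∧-true (Bool.not-injective {y = true} q)
  ... | A∋x , B∋x = x , ∋⇒∈ A∋x , ∋⇒∈ B∋x

nonemptyᵇ⇒Nonempty : ∀ {n} {A : Subset n} → nonemptyᵇ A ≡ true → Nonempty A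
nonemptyᵇ⇒Nonempty {n} p with Vertices.any-true {n} p
... | x , A∋x = x , ∋⇒∈ A∋x

Nonempty⇒nonemptyᵇ : ∀ {n} {A : Subset n} → Nonempty A → nonemptyᵇ A ≡ true
Nonempty⇒nonemptyᵇ {n} (x , x∈A) = Vertices.any-intro {n} x (∈⇒∋ x∈A)

⊆-or-witness : ∀ (A B : Subset n) → A ⊆ B ⊎ ∃[ x ] (x ∈ A × x ∉ B)
⊆-or-witness A B with any? (λ x → x ∈? A ×-dec ¬? (x ∈? B))
... | yes witness = inj₂ witness
... | no  none    = inj₁ λ {x} x∈A → decidable-stable (x ∈? B) λ x∉B → none (x , x∈A , x∉B)

⊆∧≢⇒⊂ : ∀ {A B : Subset n} → A ⊆ B → A ≢ B → A ⊂ B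
⊆∧≢⇒⊂ {A = A} {B} A⊆B A≢B with ⊆-or-witness B A
... | inj₁ B⊆A    = contradiction (⊆-antisym A⊆B B⊆A) A≢B
... | inj₂ witness = A⊆B , witness

⊂ᵇ⇒⊂ : ∀ {A B : Subset n} → (A ⊂ᵇ B) ≡ true → A ⊂ B
⊂ᵇ⇒⊂ {A = A} {B} p with ∧-true p
... | A⊆ᵇB , A≠B = ⊆∧≢⇒⊂ (⊆ᵇ⇒⊆ A⊆ᵇB) (λ A≡B → true≢false (≡⇒== A≡B) (not-true A≠B))

⊂⇒⊂ᵇ : ∀ {A B : Subset n} → A ⊂ B → (A ⊂ᵇ B) ≡ true
⊂⇒⊂ᵇ (A⊆B , x , x∈B , x∉A) = ∧-intro (⊆⇒⊆ᵇ A⊆B) (not-intro (≢⇒== λ { refl → x∉A x∈B }))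

⊆⇒≡⊎⊂ : ∀ {A B : Subset n} → A ⊆ B → A ≡ B ⊎ A ⊂ B
⊆⇒≡⊎⊂ {A = A} {B} A⊆B with ≡-dec Bool._≟_ A B
... | yes A≡B = inj₁ A≡B
... | no  A≢B = inj₂ (⊆∧≢⇒⊂ A⊆B A≢B)

⁅x⁆⊆ : ∀ {A : Subset n} {x} → x ∈ A → ⁅ x ⁆ ⊆ A
⁅x⁆⊆ {x = x} x∈A y∈⁅x⁆ = subst (_∈ _) (sym (x∈⁅y⁆⇒x≡y x y∈⁅x⁆)) x∈A

⁅x⁆⊂ : ∀ {A : Subset n} {x y} → x ∈ A → y ∈ A → y ≢ x → ⁅ x ⁆ ⊂ A
⁅x⁆⊂ x∈A y∈A y≢x = ⁅x⁆⊆ x∈A , _ , y∈A , x≢y⇒x∉⁅y⁆ y≢x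

⁅x⁆⊂⇒∈ : ∀ {A : Subset n} {x} → ⁅ x ⁆ ⊂ A → x ∈ A
⁅x⁆⊂⇒∈ {x = x} (⁅x⁆⊆A , _) = ⁅x⁆⊆A (x∈⁅x⁆ x)

⁅x⁆⊂⇒∣∣≥2 : ∀ {A : Subset n} {x} → ⁅ x ⁆ ⊂ A → 2 ≤ ∣ A ∣
⁅x⁆⊂⇒∣∣≥2 {x = x} ⁅x⁆⊂A = subst (λ k → suc k ≤ _) (∣⁅x⁆∣≡1 x) (p⊂q⇒∣p∣<∣q∣ ⁅x⁆⊂A)

∣∣≥2⇒⁅x⁆⊂ : ∀ {A : Subset n} {x} → 2 ≤ ∣ A ∣ → x ∈ A → ⁅ x ⁆ ⊂ A
∣∣≥2⇒⁅x⁆⊂ {x = x} 2≤∣A∣ x∈A with ⊆⇒≡⊎⊂ (⁅x⁆⊆ x∈A)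
... | inj₂ ⁅x⁆⊂A = ⁅x⁆⊂A
... | inj₁ refl with subst (2 ≤_) (∣⁅x⁆∣≡1 x) 2≤∣A∣
... | s≤s ()

∈-pair⁻ : ∀ {x y z : Fin n} → z ∈ ⁅ x ⁆ ∪ ⁅ y ⁆ → z ≡ x ⊎ z ≡ y
∈-pair⁻ {x = x} {y} z∈ with x∈p∪q⁻ ⁅ x ⁆ ⁅ y ⁆ z∈
... | inj₁ z∈⁅x⁆ = inj₁ (x∈⁅y⁆⇒x≡y x z∈⁅x⁆)
... | inj₂ z∈⁅y⁆ = inj₂ (x∈⁅y⁆⇒x≡y y z∈⁅y⁆)

∈-pairˡ : ∀ (x y : Fin n) → x ∈ ⁅ x ⁆ ∪ ⁅ y ⁆
∈-pairˡ x y = x∈p∪q⁺ (inj₁ (x∈⁅x⁆ x))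

∈-pairʳ : ∀ (x y : Fin n) → y ∈ ⁅ x ⁆ ∪ ⁅ y ⁆
∈-pairʳ x y = x∈p∪q⁺ (inj₂ (x∈⁅x⁆ y))

∩⊂ˡ : ∀ {A B : Subset n} {y} → y ∈ A → y ∉ B → A ∩ B ⊂ A
∩⊂ˡ {A = A} {B} y∈A y∉B = p∩q⊆p A B , _ , y∈A , y∉B ∘ proj₂ ∘ x∈p∩q⁻ A B

module Counting {S : Set} (_≟ₛ_ : DecidableEquality S) where

  count : (S → Bool) → List S → ℕ
  count p xs = length (filter (λ x → p x Bool.≟ true) xs)

  private
    length-≤-remove : ∀ y {xs} → Unique xs → length xs ≤ suc (length (filter (λ x → ¬? (x ≟ₛ y)) xs))
    length-≤-remove y {[]} _ = z≤n
    length-≤-remove y {x ∷ xs} (x∉xs ∷ xs!) with x ≟ₛ y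
    ... | no  _    = s≤s (length-≤-remove y xs!)
    ... | yes refl = s≤s (subst (λ zs → length xs ≤ length zs) (sym (filter-all _ (All.map (_∘ sym) x∉xs))) ≤-refl)

  length-≤-⊆ : ∀ {xs ys} → Unique xs → (∀ {x} → x List.∈ xs → x List.∈ ys) → length xs ≤ length ys
  length-≤-⊆ {[]}    _ _ = z≤n
  length-≤-⊆ {x ∷ _} {[]} _ xs⊆ with xs⊆ (here refl)
  ... | ()
  length-≤-⊆ {xs} {y ∷ ys} xs! xs⊆ =
    ≤-trans (length-≤-remove y xs!) (s≤s (length-≤-⊆ (Unique.filter⁺ _ xs!) rest⊆))
    where
    rest⊆ : ∀ {x} → x List.∈ filter (λ x → ¬? (x ≟ₛ y)) xs → x List.∈ ys
    rest⊆ x∈ with ∈-filter⁻ (λ x → ¬? (x ≟ₛ y)) x∈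
    ... | x∈xs , x≢y with xs⊆ x∈xs
    ... | here x≡y = contradiction x≡y x≢y
    ... | there x∈ys = x∈ys

  count-split : ∀ (p r : S → Bool) xs → count p xs ≤ count (λ x → p x ∧ r x) xs + count (λ x → p x ∧ not (r x)) xs
  count-split p r []       = z≤n
  count-split p r (x ∷ xs) with p x | r x
  ... | false | _     = count-split p r xs
  ... | true  | true  = s≤s (count-split p r xs)
  ... | true  | false = subst (suc (count p xs) ≤_) (sym (+-suc _ _)) (s≤s (count-split p r xs))

  count-≤1 : ∀ (p : S → Bool) {xs} → Unique xs → (∀ {x y} → p x ≡ true → p y ≡ true → x ≡ y) → count p xs ≤ 1
  count-≤1 p {[]} _ _ = z≤n
  count-≤1 p {x ∷ xs} (x∉xs ∷ xs!) p-unique with p x in px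
  ... | false = count-≤1 p xs! p-unique
  ... | true  = s≤s (≤-reflexive (cong length (filter-none _ (All.map (λ x≢y py → x≢y (p-unique px py)) x∉xs))))

  map-unique : ∀ (f : S → S) {xs} → Unique xs →
    (∀ {x y} → x List.∈ xs → y List.∈ xs → f x ≡ f y → x ≡ y) → Unique (map f xs)
  map-unique f {[]} [] _ = []
  map-unique f {x ∷ xs} (x∉xs ∷ xs!) f-inj =
    All⁺.map⁺ (All.tabulate λ y∈xs fx≡fy → All.lookup x∉xs y∈xs (f-inj (here refl) (there y∈xs) fx≡fy))
    ∷ map-unique f xs! λ x∈ y∈ → f-inj (there x∈) (there y∈)

  count-injective : ∀ (f : S → S) (p q : S → Bool) {xs} → Unique xs → (∀ x → x List.∈ xs) →
    (∀ {x} → p x ≡ true → q (f x) ≡ true) →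
    (∀ {x y} → p x ≡ true → p y ≡ true → f x ≡ f y → x ≡ y) →
    count p xs ≤ count q xs
  count-injective f p q {xs} xs! complete pq f-inj =
    subst (_≤ count q xs) (length-map f (filter (λ x → p x Bool.≟ true) xs))
      (length-≤-⊆ (map-unique f (Unique.filter⁺ _ xs!) λ x∈ y∈ → f-inj (selected x∈) (selected y∈)) image⊆)
    where
    selected : ∀ {x} → x List.∈ filter (λ x → p x Bool.≟ true) xs → p x ≡ true
    selected x∈ = proj₂ (∈-filter⁻ (λ x → p x Bool.≟ true) {xs = xs} x∈)
    image⊆ : ∀ {y} → y List.∈ map f (filter (λ x → p x Bool.≟ true) xs) → y List.∈ filter (λ x → q x Bool.≟ true) xs
    image⊆ y∈ with ∈-map⁻ f y∈
    ... | x , x∈ , refl = ∈-filter⁺ (λ x → q x Bool.≟ true) (complete (f x)) (pq (selected x∈))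

Splits : ∀ {n} → (Fin n → Fin n → Bool) → Subset n → Set
Splits E M = ∃[ A ] (A ⊂ M × Nonempty A × (∀ {a b} → a ∈ A → b ∈ M → b ∉ A → E a b ≡ false))

module _ {n} (E : Fin n → Fin n → Bool) {M : Subset n} where

  disconnectedIn⇒Splits : disconnectedIn E M ≡ true → Splits E M
  disconnectedIn⇒Splits p with Subsets.any-true {n} p
  ... | A , q with ∧-true q
  ... | A⊆ᵇM , q with ∧-true q
  ... | A≠∅ , q with ∧-true q
  ... | A≠M , noEdge =
    A , ⊆∧≢⇒⊂ (⊆ᵇ⇒⊆ A⊆ᵇM) (λ A≡M → true≢false (≡⇒== A≡M) (not-true A≠M)) , nonemptyᵇ⇒Nonempty A≠∅ ,
    λ {a} {b} a∈A b∈M b∉A →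
      not-true (implies-true (Vertices.all-true {n} (Vertices.all-true {n} noEdge a) b)
                 (∧-intro (∈⇒∋ a∈A) (∧-intro (∈⇒∋ b∈M) (not-intro (∉⇒∋ b∉A)))))

  Splits⇒disconnectedIn : Splits E M → disconnectedIn E M ≡ true
  Splits⇒disconnectedIn (A , (A⊆M , m , m∈M , m∉A) , A≠∅ , noEdge) =
    Subsets.any-intro {n} A
      (∧-intro (⊆⇒⊆ᵇ A⊆M) (∧-intro (Nonempty⇒nonemptyᵇ A≠∅) (∧-intro (not-intro (≢⇒== λ { refl → m∉A m∈M }))
        (Vertices.all-intro {n} λ a → Vertices.all-intro {n} λ b → implies-intro λ q →
          let (A∋a , r) = ∧-true q ; (M∋b , A∌b) = ∧-true r
          in not-intro (noEdge (∋⇒∈ A∋a) (∋⇒∈ M∋b) (∋⇒∉ (not-true A∌b)))))))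

module Decomposition {n} (G : Graph n) where

  E : Fin n → Fin n → Bool
  E = adj G

  Module : Subset n → Set
  Module M = ∀ {z a b} → z ∉ M → a ∈ M → b ∈ M → E z a ≡ E z b

  record Strong (M : Subset n) : Set where
    field
      nonempty : Nonempty M
      modular  : Module M
      nested   : ∀ {W} → Module W → ∀ {c} → c ∈ M → c ∈ W → M ⊆ W ⊎ W ⊆ M

  LeafChild : Subset n → Fin n → Set
  LeafChild M x = ⁅ x ⁆ ⊂ M × (∀ {W} → Strong W → ⁅ x ⁆ ⊂ W → ¬ W ⊂ M)

  -- A node is labelled by the adjacency between its leaf children: P-nodes by false, S-nodes by true.
  labelled : Bool → Subset n → Bool
  labelled false = labelP G
  labelled true  = labelS G

  Degenerate : Subset n → Set
  Degenerate M = ∃[ b ] labelled b M ≡ true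

  Twin : Fin n → Fin n → Set
  Twin x y = ∀ z → z ≢ x → z ≢ y → E x z ≡ E y z

  isModule⇒Module : ∀ {M} → isModule G M ≡ true → Module M
  isModule⇒Module {M} p {z} {a} {b} z∉M a∈M b∈M with ∨-true (Vertices.all-true {n} p z)
  ... | inj₁ M∋z = contradiction (∋⇒∈ M∋z) z∉M
  ... | inj₂ q   = does-true (Bool._≟_ (E z a) (E z b))
                     (implies-true (Vertices.all-true {n} (Vertices.all-true {n} q a) b)
                                   (∧-intro (∈⇒∋ a∈M) (∈⇒∋ b∈M)))

  Module⇒isModule : ∀ {M} → Module M → isModule G M ≡ true
  Module⇒isModule {M} h = Vertices.all-intro {n} λ z → case z ∈? M of λ where
    (yes z∈M) → ∨-introˡ (∈⇒∋ z∈M)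
    (no  z∉M) → ∨-introʳ {M ∋ z} (Vertices.all-intro {n} λ a → Vertices.all-intro {n} λ b →
      implies-intro λ q → let (M∋a , M∋b) = ∧-true q in
        does-intro (Bool._≟_ (E z a) (E z b)) (h z∉M (∋⇒∈ M∋a) (∋⇒∈ M∋b)))

  isStrong⇒Strong : ∀ {M} → isStrong G M ≡ true → Strong M
  isStrong⇒Strong {M} p with ∧-true p
  ... | M≠∅ , q with ∧-true q
  ... | M-module , nestedᵇ = record
    { nonempty = nonemptyᵇ⇒Nonempty M≠∅
    ; modular  = isModule⇒Module M-module
    ; nested   = λ {W} W-module c∈M c∈W →
        case-nested (∨-true (implies-true (Subsets.all-true {n} nestedᵇ W) (Module⇒isModule W-module))) c∈M c∈W
    }
    where
    case-nested : ∀ {W c} → disjointᵇ M W ≡ true ⊎ (M ⊆ᵇ W) ∨ (W ⊆ᵇ M) ≡ true →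
                  c ∈ M → c ∈ W → M ⊆ W ⊎ W ⊆ M
    case-nested (inj₁ disjoint) c∈M c∈W = contradiction c∈W (disjointᵇ⇒∉ disjoint c∈M)
    case-nested (inj₂ q) _ _ with ∨-true q
    ... | inj₁ M⊆W = inj₁ (⊆ᵇ⇒⊆ M⊆W)
    ... | inj₂ W⊆M = inj₂ (⊆ᵇ⇒⊆ W⊆M)

  Strong⇒isStrong : ∀ {M} → Strong M → isStrong G M ≡ true
  Strong⇒isStrong {M} sM = ∧-intro (Nonempty⇒nonemptyᵇ nonempty) (∧-intro (Module⇒isModule modular)
    (Subsets.all-intro {n} λ W → implies-intro (nestedᵇ W ∘ isModule⇒Module)))
    where
    open Strong sM
    nestedᵇ : ∀ W → Module W → disjointᵇ M W ∨ ((M ⊆ᵇ W) ∨ (W ⊆ᵇ M)) ≡ true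
    nestedᵇ W W-module with disjointᵇ M W in disjoint
    ... | true  = refl
    ... | false with disjointᵇ-false disjoint
    ... | c , c∈M , c∈W with nested W-module c∈M c∈W
    ... | inj₁ M⊆W = ∨-introˡ (⊆⇒⊆ᵇ M⊆W)
    ... | inj₂ W⊆M = ∨-introʳ {M ⊆ᵇ W} (⊆⇒⊆ᵇ W⊆M)

  isLeafChild⇒LeafChild : ∀ {M x} → isLeafChild G M x ≡ true → LeafChild M x
  isLeafChild⇒LeafChild {M} {x} p with ∧-true p
  ... | x⊂M , noMiddle = ⊂ᵇ⇒⊂ x⊂M , λ {W} sW x⊂W W⊂M →
    true≢false (∧-intro (Strong⇒isStrong sW) (∧-intro (⊂⇒⊂ᵇ x⊂W) (⊂⇒⊂ᵇ W⊂M)))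
               (not-true (Subsets.all-true {n} noMiddle W))

  LeafChild⇒isLeafChild : ∀ {M x} → LeafChild M x → isLeafChild G M x ≡ true
  LeafChild⇒isLeafChild (x⊂M , noMiddle) = ∧-intro (⊂⇒⊂ᵇ x⊂M) (Subsets.all-intro {n} λ W → not-intro (Bool.¬-not λ q →
    let (sW , r) = ∧-true q ; (x⊂W , W⊂M) = ∧-true r
    in noMiddle (isStrong⇒Strong sW) (⊂ᵇ⇒⊂ x⊂W) (⊂ᵇ⇒⊂ W⊂M)))

  degenerate? : ∀ M → Dec (Degenerate M)
  degenerate? M with labelP G M in P | labelS G M in S
  ... | true  | _     = yes (false , P)
  ... | false | true  = yes (true , S)
  ... | false | false = no λ { (false , P′) → true≢false P′ P ; (true , S′) → true≢false S′ S }

  uniform-cut⇒labelled : ∀ {M A} → A ⊂ M → Nonempty A → ∀ c →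
    (∀ {p q} → p ∈ A → q ∈ M → q ∉ A → E p q ≡ c) → labelled c M ≡ true
  uniform-cut⇒labelled A⊂M A≠∅ false uniform =
    Splits⇒disconnectedIn E (_ , A⊂M , A≠∅ , uniform)
  uniform-cut⇒labelled A⊂M A≠∅ true uniform =
    Splits⇒disconnectedIn (complementAdj G) (_ , A⊂M , A≠∅ , λ {p} {q} p∈A q∈M q∉A →
      trans (cong (λ e → not ⌊ p ≟ q ⌋ ∧ not e) (uniform p∈A q∈M q∉A)) (Bool.∧-zeroʳ _))

  overlap⇒degenerate : ∀ {M A B a b} → Module A → Module B → A ⊆ M → a ∈ A → a ∉ B →
    b ∈ M → b ∉ A → (∀ {m} → m ∈ M → m ∉ A → m ∈ B) → Degenerate M
  overlap⇒degenerate {a = a} {b} A-mod B-mod A⊆M a∈A a∉B b∈M b∉A M─A⊆B =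
    E a b , uniform-cut⇒labelled (A⊆M , b , b∈M , b∉A) (a , a∈A) (E a b) λ {p} {q} p∈A q∈M q∉A → begin
      E p q ≡⟨ adj-sym G p q ⟩
      E q p ≡⟨ A-mod q∉A p∈A a∈A ⟩
      E q a ≡⟨ adj-sym G q a ⟩
      E a q ≡⟨ B-mod a∉B (M─A⊆B q∈M q∉A) (M─A⊆B b∈M b∉A) ⟩
      E a b ∎
    where open ≡-Reasoning

  twin-pair-module : ∀ {x y} → Twin x y → Module (⁅ x ⁆ ∪ ⁅ y ⁆)
  twin-pair-module {x} {y} twin {z} z∉D a∈D b∈D = trans (E-zx a∈D) (sym (E-zx b∈D))
    where
    E-zx : ∀ {c} → c ∈ ⁅ x ⁆ ∪ ⁅ y ⁆ → E z c ≡ E z x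
    E-zx c∈D with ∈-pair⁻ c∈D
    ... | inj₁ refl = refl
    ... | inj₂ refl = begin
      E z y ≡⟨ adj-sym G z y ⟩
      E y z ≡⟨ twin z (λ { refl → z∉D (∈-pairˡ x y) }) (λ { refl → z∉D (∈-pairʳ x y) }) ⟨
      E x z ≡⟨ adj-sym G x z ⟩
      E z x ∎
      where open ≡-Reasoning

  ∪-module : ∀ {A B c} → Module A → Module B → c ∈ A → c ∈ B → Module (A ∪ B)
  ∪-module {A} {B} {c} A-mod B-mod c∈A c∈B {z} z∉A∪B a∈ b∈ = trans (E-zc a∈) (sym (E-zc b∈))
    where
    E-zc : ∀ {d} → d ∈ A ∪ B → E z d ≡ E z c
    E-zc {d} d∈ with x∈p∪q⁻ A B d∈
    ... | inj₁ d∈A = A-mod (z∉A∪B ∘ x∈p∪q⁺ ∘ inj₁) d∈A c∈A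
    ... | inj₂ d∈B = B-mod (z∉A∪B ∘ x∈p∪q⁺ ∘ inj₂) d∈B c∈B

  strong-twin-closed : ∀ {M x y} → Strong M → ⁅ x ⁆ ⊂ M → Twin x y → y ∈ M
  strong-twin-closed {M} {x} {y} sM x⊂M@(_ , o , o∈M , o∉⁅x⁆) twin
    with Strong.nested sM (twin-pair-module twin) (⁅x⁆⊂⇒∈ x⊂M) (∈-pairˡ x y)
  ... | inj₂ D⊆M = D⊆M (∈-pairʳ x y)
  ... | inj₁ M⊆D with ∈-pair⁻ (M⊆D o∈M)
  ... | inj₁ refl = contradiction (x∈⁅x⁆ o) o∉⁅x⁆
  ... | inj₂ refl = o∈M

  -- Such a W would be strong, contradicting that x is a leaf child: a module V overlapping W lies in M,
  -- and V ∪ W either covers M, making all edges across the cut W | M ∖ W equal, or is a larger such W.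
  nondegenerate⇒submodules-absorbed : ∀ {M x W} → Strong M → LeafChild M x → ¬ Degenerate M →
    Module W → ⁅ x ⁆ ⊂ W → ¬ W ⊂ M
  nondegenerate⇒submodules-absorbed {M} {x} sM (_ , noMiddle) ¬deg = absorbed (⊃-wellFounded _)
    where
    absorbed : ∀ {W} → Acc _⊃_ W → Module W → ⁅ x ⁆ ⊂ W → ¬ W ⊂ M
    absorbed {W} (acc larger) W-mod x⊂W W⊂M@(W⊆M , m , m∈M , m∉W) = noMiddle sW x⊂W W⊂M
      where
      nestedW : ∀ {V} → Module V → ∀ {c} → c ∈ W → c ∈ V → W ⊆ V ⊎ V ⊆ W
      nestedW {V} V-mod c∈W c∈V with Strong.nested sM V-mod (W⊆M c∈W) c∈V
      ... | inj₁ M⊆V = inj₁ (M⊆V ∘ W⊆M)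
      ... | inj₂ V⊆M with ⊆-or-witness W V | ⊆-or-witness V W
      ... | inj₁ W⊆V | _        = inj₁ W⊆V
      ... | inj₂ _   | inj₁ V⊆W = inj₂ V⊆W
      ... | inj₂ (w , w∈W , w∉V) | inj₂ (v , v∈V , v∉W) with ⊆-or-witness M (V ∪ W)
      ... | inj₁ M⊆V∪W = contradiction
              (overlap⇒degenerate W-mod V-mod W⊆M w∈W w∉V m∈M m∉W λ {m′} m′∈M m′∉W →
                 [ (λ m′∈V → m′∈V) , (λ m′∈W → contradiction m′∈W m′∉W) ]′ (x∈p∪q⁻ V W (M⊆V∪W m′∈M)))
              ¬deg
      ... | inj₂ (m′ , m′∈M , m′∉V∪W) = ⊥-elim
              (absorbed (larger W⊂V∪W) (∪-module V-mod W-mod c∈V c∈W)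
                 (⊂-⊆-trans x⊂W (proj₁ W⊂V∪W))
                 ((λ y∈V∪W → [ V⊆M , W⊆M ]′ (x∈p∪q⁻ V W y∈V∪W)) , m′ , m′∈M , m′∉V∪W))
        where
        W⊂V∪W : W ⊂ V ∪ W
        W⊂V∪W = (λ y∈W → x∈p∪q⁺ (inj₂ y∈W)) , v , x∈p∪q⁺ (inj₁ v∈V) , v∉W
      sW : Strong W
      sW = record { nonempty = x , ⁅x⁆⊂⇒∈ x⊂W ; modular = W-mod ; nested = nestedW }

  twin⇒degenerate : ∀ {M x y} → Strong M → LeafChild M x → Twin x y → y ≢ x → Degenerate M
  twin⇒degenerate {M} {x} {y} sM lx twin y≢x with degenerate? M
  ... | yes deg = deg
  ... | no ¬deg with ⊆-or-witness M (⁅ x ⁆ ∪ ⁅ y ⁆)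
  ... | inj₁ M⊆D = E x y , uniform-cut⇒labelled x⊂M (x , x∈⁅x⁆ x) (E x y) λ p∈⁅x⁆ q∈M q∉⁅x⁆ →
          cong₂ E (x∈⁅y⁆⇒x≡y x p∈⁅x⁆) (the-other (M⊆D q∈M) q∉⁅x⁆)
    where
    x⊂M : ⁅ x ⁆ ⊂ M
    x⊂M = ⁅x⁆⊂ (⁅x⁆⊂⇒∈ (proj₁ lx)) (strong-twin-closed sM (proj₁ lx) twin) y≢x
    the-other : ∀ {q} → q ∈ ⁅ x ⁆ ∪ ⁅ y ⁆ → q ∉ ⁅ x ⁆ → q ≡ y
    the-other q∈D q∉⁅x⁆ with ∈-pair⁻ q∈D
    ... | inj₁ refl = contradiction (x∈⁅x⁆ x) q∉⁅x⁆
    ... | inj₂ q≡y  = q≡y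
  ... | inj₂ (m , m∈M , m∉D) = ⊥-elim (nondegenerate⇒submodules-absorbed sM lx ¬deg (twin-pair-module twin)
          (⁅x⁆⊂ (∈-pairˡ x y) (∈-pairʳ x y) y≢x) (D⊆M , m , m∈M , m∉D))
    where
    D⊆M : ⁅ x ⁆ ∪ ⁅ y ⁆ ⊆ M
    D⊆M d∈D with ∈-pair⁻ d∈D
    ... | inj₁ refl = ⁅x⁆⊂⇒∈ (proj₁ lx)
    ... | inj₂ refl = strong-twin-closed sM (proj₁ lx) twin

  Closed : Subset n → Subset n → Set
  Closed M S = S ⊆ M × (∀ {p q} → p ∈ S → q ∈ M → q ∉ S → E p q ≡ false)

  closed⇒module : ∀ {M S} → Module M → Closed M S → Module S
  closed⇒module {M} M-mod (S⊆M , closed) {v} {p} {q} v∉S p∈S q∈S with v ∈? M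
  ... | no  v∉M = M-mod v∉M (S⊆M p∈S) (S⊆M q∈S)
  ... | yes v∈M = trans (trans (adj-sym G v p) (closed p∈S v∈M v∉S))
                        (sym (trans (adj-sym G v q) (closed q∈S v∈M v∉S)))

  closed-complement : ∀ {M S} → Closed M S → Closed M (M ∩ ∁ S)
  closed-complement {M} {S} (_ , closed) = p∩q⊆p M (∁ S) , λ {p} {q} p∈ q∈M q∉ →
    let (p∈M , p∈∁S) = x∈p∩q⁻ M (∁ S) p∈
        q∈S = decidable-stable (q ∈? S) (q∉ ∘ x∈p∩q⁺ ∘ (q∈M ,_) ∘ x∉p⇒x∈∁p)
    in trans (adj-sym G p q) (closed q∈S p∈M (x∈∁p⇒x∉p p∈∁S))

  closed-cut-by-module : ∀ {M S V w} → Closed M S → Module V → V ⊆ M → w ∈ V → w ∉ S →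
    Closed M (S ∩ V) × Closed M (S ∩ ∁ V)
  closed-cut-by-module {M} {S} {V} (S⊆M , closed) V-mod V⊆M w∈V w∉S =
    (S⊆M ∘ p∩q⊆p S V , closed-inside) , (S⊆M ∘ p∩q⊆p S (∁ V) , closed-outside)
    where
    no-cross : ∀ {p q} → p ∈ S → p ∈ V → q ∈ S → q ∉ V → E p q ≡ false
    no-cross {p} {q} p∈S p∈V q∈S q∉V =
      trans (adj-sym G p q) (trans (V-mod q∉V p∈V w∈V) (closed q∈S (V⊆M w∈V) w∉S))
    closed-inside : ∀ {p q} → p ∈ S ∩ V → q ∈ M → q ∉ S ∩ V → E p q ≡ false
    closed-inside {p} {q} p∈ q∈M q∉ with x∈p∩q⁻ S V p∈ | q ∈? S
    ... | p∈S , _   | no  q∉S = closed p∈S q∈M q∉S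
    ... | p∈S , p∈V | yes q∈S = no-cross p∈S p∈V q∈S (q∉ ∘ x∈p∩q⁺ ∘ (q∈S ,_))
    closed-outside : ∀ {p q} → p ∈ S ∩ ∁ V → q ∈ M → q ∉ S ∩ ∁ V → E p q ≡ false
    closed-outside {p} {q} p∈ q∈M q∉ with x∈p∩q⁻ S (∁ V) p∈ | q ∈? S
    ... | p∈S , _    | no  q∉S = closed p∈S q∈M q∉S
    ... | p∈S , p∈∁V | yes q∈S = trans (adj-sym G p q)
          (no-cross q∈S (decidable-stable (q ∈? V) (q∉ ∘ x∈p∩q⁺ ∘ (q∈S ,_) ∘ x∉p⇒x∈∁p))
                    p∈S (x∈∁p⇒x∉p p∈∁V))

  -- A neighbour z of x lies in every closed part of M containing x; a module meeting such a part without
  -- nesting cuts it into two smaller closed parts, so the smallest one would be a strong module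
  -- strictly between {x} and M.
  split⇒leafChild-isolated : ∀ {M x z} → Strong M → Splits E M → LeafChild M x → z ∈ M → E x z ≡ false
  split⇒leafChild-isolated {M} {x} {z} sM (A , A⊂M , (a , a∈A) , noEdge) (x⊂M , noMiddle) z∈M =
    Bool.¬-not λ xz → case x ∈? A of λ where
      (yes x∈A) → absorbed xz (⊂-wellFounded _) (proj₁ A⊂M , noEdge) x∈A A⊂M
      (no  x∉A) → absorbed xz (⊂-wellFounded _) (closed-complement (proj₁ A⊂M , noEdge))
                    (x∈p∩q⁺ (⁅x⁆⊂⇒∈ x⊂M , x∉p⇒x∈∁p x∉A)) (∩⊂ˡ (proj₁ A⊂M a∈A) (x∈p⇒x∉∁p a∈A))
    where
    absorbed : E x z ≡ true → ∀ {S} → Acc _⊂_ S → Closed M S → x ∈ S → ¬ S ⊂ M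
    absorbed xz {S} (acc smaller) S-closed@(S⊆M , closed) x∈S S⊂M = noMiddle sS (⁅x⁆⊂ x∈S z∈S z≢x) S⊂M
      where
      z∈S : z ∈ S
      z∈S = decidable-stable (z ∈? S) λ z∉S → true≢false xz (closed x∈S z∈M z∉S)
      z≢x : z ≢ x
      z≢x refl = true≢false xz (adj-irrefl G z)
      nestedS : ∀ {V} → Module V → ∀ {c} → c ∈ S → c ∈ V → S ⊆ V ⊎ V ⊆ S
      nestedS {V} V-mod {c} c∈S c∈V with Strong.nested sM V-mod (S⊆M c∈S) c∈V
      ... | inj₁ M⊆V = inj₁ (M⊆V ∘ S⊆M)
      ... | inj₂ V⊆M with ⊆-or-witness S V | ⊆-or-witness V S
      ... | inj₁ S⊆V | _        = inj₁ S⊆V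
      ... | inj₂ _   | inj₁ V⊆S = inj₂ V⊆S
      ... | inj₂ (s , s∈S , s∉V) | inj₂ (w , w∈V , w∉S)
            with closed-cut-by-module S-closed V-mod V⊆M w∈V w∉S | x ∈? V
      ... | inside , _ | yes x∈V = ⊥-elim (absorbed xz (smaller (∩⊂ˡ s∈S s∉V)) inside
                                      (x∈p∩q⁺ (x∈S , x∈V)) (⊂-trans (∩⊂ˡ s∈S s∉V) S⊂M))
      ... | _ , outside | no x∉V = ⊥-elim (absorbed xz (smaller S─V⊂S) outside
                                      (x∈p∩q⁺ (x∈S , x∉p⇒x∈∁p x∉V)) (⊂-trans S─V⊂S S⊂M))
        where
        S─V⊂S : S ∩ ∁ V ⊂ S
        S─V⊂S = ∩⊂ˡ c∈S (x∈p⇒x∉∁p c∈V)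
      sS : Strong S
      sS = record { nonempty = x , x∈S ; modular = closed⇒module (Strong.modular sM) S-closed ; nested = nestedS }

  twin-leafChild : ∀ {M x y} → Strong M → LeafChild M x → Twin x y → y ≢ x → LeafChild M y
  twin-leafChild {M} {x} {y} sM (x⊂M , noMiddle) twin y≢x =
    ⁅x⁆⊂ (strong-twin-closed sM x⊂M twin) (⁅x⁆⊂⇒∈ x⊂M) (y≢x ∘ sym) , noMiddleʸ
    where
    noMiddleʸ : ∀ {W} → Strong W → ⁅ y ⁆ ⊂ W → ¬ W ⊂ M
    noMiddleʸ {W} sW y⊂W@(_ , w , w∈W , w∉⁅y⁆) W⊂M with x ∈? W
    ... | yes x∈W = noMiddle sW (⁅x⁆⊂ x∈W (⁅x⁆⊂⇒∈ y⊂W) y≢x) W⊂M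
    ... | no  x∉W with Strong.nested sW (twin-pair-module twin) (⁅x⁆⊂⇒∈ y⊂W) (∈-pairʳ x y)
    ...   | inj₂ D⊆W = x∉W (D⊆W (∈-pairˡ x y))
    ...   | inj₁ W⊆D with ∈-pair⁻ (W⊆D w∈W)
    ...     | inj₁ refl = x∉W w∈W
    ...     | inj₂ refl = w∉⁅y⁆ (x∈⁅x⁆ w)

  leafChild-exists : ∀ {x y} → y ≢ x → ∃[ M ] (Strong M × LeafChild M x)
  leafChild-exists {x} {y} y≢x = descend (⊂-wellFounded ⊤) ⊤-strong (⁅x⁆⊂ ∈⊤ ∈⊤ y≢x)
    where
    ⊤-strong : Strong ⊤
    ⊤-strong = record
      { nonempty = x , ∈⊤
      ; modular  = λ z∉⊤ → contradiction ∈⊤ z∉⊤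
      ; nested   = λ _ _ _ → inj₂ (λ _ → ∈⊤)
      }
    descend : ∀ {M} → Acc _⊂_ M → Strong M → ⁅ x ⁆ ⊂ M → ∃[ M ] (Strong M × LeafChild M x)
    descend {M} (acc smaller) sM x⊂M with isLeafChild G M x in lc
    ... | true  = M , sM , isLeafChild⇒LeafChild lc
    ... | false with Subsets.all-false {n} (∧-false (⊂⇒⊂ᵇ x⊂M) lc)
    ... | W , q with ∧-true {isStrong G W} (Bool.not-injective {y = true} q)
    ... | sW , r with ∧-true {⁅ x ⁆ ⊂ᵇ W} r
    ... | x⊂W , W⊂M = descend (smaller (⊂ᵇ⇒⊂ {A = W} W⊂M)) (isStrong⇒Strong {W} sW) (⊂ᵇ⇒⊂ {B = W} x⊂W)

another-vertex : 2 ≤ n → (x : Fin n) → ∃[ y ] y ≢ x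
another-vertex (s≤s (s≤s _)) zero    = suc zero , λ ()
another-vertex (s≤s (s≤s _)) (suc x) = zero , λ ()

⌊≟⌋-sym : ∀ {n} (x y : Fin n) → ⌊ x ≟ y ⌋ ≡ ⌊ y ≟ x ⌋
⌊≟⌋-sym x y with x ≟ y | y ≟ x
... | yes _   | yes _   = refl
... | no  _   | no  _   = refl
... | yes x≡y | no  y≢x = contradiction (sym x≡y) y≢x
... | no  x≢y | yes y≡x = contradiction (sym y≡x) x≢y

complement : ∀ {n} → Graph n → Graph n
complement G = record
  { adj        = complementAdj G
  ; adj-sym    = λ x y → cong₂ (λ e f → not e ∧ not f) (⌊≟⌋-sym x y) (adj-sym G x y)
  ; adj-irrefl = λ x → cong (λ e → not e ∧ not (adj G x x)) (does-intro (x ≟ x) refl)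
  }

module TwinClasses {n} (G : Graph n) where

  open Decomposition G public
  private
    module C = Decomposition (complement G)

  complementAdj-distinct : ∀ {x y} → x ≢ y → complementAdj G x y ≡ not (E x y)
  complementAdj-distinct {x} {y} x≢y = cong (λ e → not e ∧ not (E x y)) (does-false (x ≟ y) x≢y)

  private
    ∉⇒≢ : ∀ {M : Subset n} {x y} → x ∉ M → y ∈ M → x ≢ y
    ∉⇒≢ x∉M y∈M refl = x∉M y∈M

  module-complement : ∀ {M} → Module M → C.Module M
  module-complement M-mod z∉M a∈M b∈M =
    trans (complementAdj-distinct (∉⇒≢ z∉M a∈M))
          (trans (cong not (M-mod z∉M a∈M b∈M)) (sym (complementAdj-distinct (∉⇒≢ z∉M b∈M))))

  complement-module : ∀ {M} → C.Module M → Module M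
  complement-module M-mod z∉M a∈M b∈M = Bool.not-injective
    (trans (sym (complementAdj-distinct (∉⇒≢ z∉M a∈M)))
           (trans (M-mod z∉M a∈M b∈M) (complementAdj-distinct (∉⇒≢ z∉M b∈M))))

  strong-complement : ∀ {M} → Strong M → C.Strong M
  strong-complement sM = record
    { nonempty = Strong.nonempty sM
    ; modular  = module-complement (Strong.modular sM)
    ; nested   = Strong.nested sM ∘ complement-module
    }

  complement-strong : ∀ {M} → C.Strong M → Strong M
  complement-strong sM = record
    { nonempty = C.Strong.nonempty sM
    ; modular  = complement-module (C.Strong.modular sM)
    ; nested   = C.Strong.nested sM ∘ module-complement
    }

  leafChild-complement : ∀ {M x} → LeafChild M x → C.LeafChild M x
  leafChild-complement (x⊂M , noMiddle) = x⊂M , noMiddle ∘ complement-strong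

  labelled-leafChild-adjacency : ∀ b {M x z} → Strong M → labelled b M ≡ true → LeafChild M x →
    z ∈ M → z ≢ x → E x z ≡ b
  labelled-leafChild-adjacency false sM P lc z∈M _ =
    split⇒leafChild-isolated sM (disconnectedIn⇒Splits E P) lc z∈M
  labelled-leafChild-adjacency true sM S lc z∈M z≢x = Bool.not-injective
    (trans (sym (complementAdj-distinct (z≢x ∘ sym)))
           (C.split⇒leafChild-isolated (strong-complement sM) (disconnectedIn⇒Splits (complementAdj G) S)
                                       (leafChild-complement lc) z∈M))

  twin-refl : ∀ {x} → Twin x x
  twin-refl _ _ _ = refl

  twin-sym : ∀ {x y} → Twin x y → Twin y x
  twin-sym twin z z≢y z≢x = sym (twin z z≢x z≢y)

  twin-trans : ∀ {x y z} → Twin x y → Twin y z → Twin x z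
  twin-trans {x} {y} {z} xy yz w w≢x w≢z with w ≟ y
  ... | no  w≢y = trans (xy w w≢x w≢y) (yz w w≢y w≢z)
  ... | yes refl with x ≟ z
  ...   | yes refl = refl
  ...   | no  x≢z = begin
    E x w ≡⟨ adj-sym G x w ⟩
    E w x ≡⟨ yz x (w≢x ∘ sym) x≢z ⟩
    E z x ≡⟨ adj-sym G z x ⟩
    E x z ≡⟨ xy z (x≢z ∘ sym) (w≢z ∘ sym) ⟩
    E w z ≡⟨ adj-sym G w z ⟩
    E z w ∎
    where open ≡-Reasoning

  record TwinClass (A : Subset n) (x : Fin n) : Set where
    field
      twin-of : ∀ {y} → y ∈ A → Twin x y
      member  : ∀ {y} → Twin x y → y ∈ A

  open TwinClass public

  twinClass-∋ : ∀ {A x} → TwinClass A x → x ∈ A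
  twinClass-∋ cl = member cl twin-refl

  twinClasses-meet⇒≡ : ∀ {A B x y w} → TwinClass A x → TwinClass B y → w ∈ A → w ∈ B → A ≡ B
  twinClasses-meet⇒≡ clA clB w∈A w∈B = ⊆-antisym (included clA clB w∈A w∈B) (included clB clA w∈B w∈A)
    where
    included : ∀ {A B x y w} → TwinClass A x → TwinClass B y → w ∈ A → w ∈ B → A ⊆ B
    included clA clB w∈A w∈B z∈A =
      member clB (twin-trans (twin-of clB w∈B) (twin-trans (twin-sym (twin-of clA w∈A)) (twin-of clA z∈A)))

  leafChild⇒∈ : ∀ {M y} → LeafChild M y → y ∈ leafChildren G M
  leafChild⇒∈ {M} {y} lc = ∋⇒∈ (trans (lookup∘tabulate (isLeafChild G M) y) (LeafChild⇒isLeafChild lc))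

  ∈⇒leafChild : ∀ {M y} → y ∈ leafChildren G M → LeafChild M y
  ∈⇒leafChild {M} {y} y∈ = isLeafChild⇒LeafChild (trans (sym (lookup∘tabulate (isLeafChild G M) y)) (∈⇒∋ y∈))

  labelled-leafChildren-twinClass : ∀ {b M x} → Strong M → labelled b M ≡ true → LeafChild M x →
    TwinClass (leafChildren G M) x
  labelled-leafChildren-twinClass {b} {M} {x} sM lab lx = record { twin-of = twin-of′ ; member = member′ }
    where
    twin-of′ : ∀ {y} → y ∈ leafChildren G M → Twin x y
    twin-of′ {y} y∈L z z≢x z≢y with z ∈? M
    ... | yes z∈M = trans (labelled-leafChild-adjacency b sM lab lx z∈M z≢x)
                          (sym (labelled-leafChild-adjacency b sM lab (∈⇒leafChild y∈L) z∈M z≢y))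
    ... | no  z∉M = trans (adj-sym G x z) (trans (Strong.modular sM z∉M (⁅x⁆⊂⇒∈ (proj₁ lx))
                            (⁅x⁆⊂⇒∈ (proj₁ (∈⇒leafChild y∈L)))) (adj-sym G z y))
    member′ : ∀ {y} → Twin x y → y ∈ leafChildren G M
    member′ {y} twin with y ≟ x
    ... | yes refl = leafChild⇒∈ lx
    ... | no  y≢x  = leafChild⇒∈ (twin-leafChild sM lx twin y≢x)

  Twinless : Fin n → Set
  Twinless x = ∀ {y} → Twin x y → y ≡ x

  twinless⇒singleton-twinClass : ∀ {x} → Twinless x → TwinClass ⁅ x ⁆ x
  twinless⇒singleton-twinClass {x} twinless = record
    { twin-of = λ y∈⁅x⁆ → subst (Twin x) (sym (x∈⁅y⁆⇒x≡y x y∈⁅x⁆)) twin-refl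
    ; member  = λ twin → subst (_∈ ⁅ x ⁆) (sym (twinless twin)) (x∈⁅x⁆ x)
    }

  nondegenerate⇒leafChild-twinless : ∀ {M x} → Strong M → ¬ Degenerate M → LeafChild M x → Twinless x
  nondegenerate⇒leafChild-twinless {x = x} sM ¬deg lx {y} twin with y ≟ x
  ... | yes y≡x = y≡x
  ... | no  y≢x = contradiction (twin⇒degenerate sM lx twin y≢x) ¬deg

  internal⇒strong : ∀ {M} → isInternal G M ≡ true → Strong M
  internal⇒strong {M} p = isStrong⇒Strong (proj₁ (∧-true {isStrong G M} p))

  leafChild⇒internal : ∀ {M x} → Strong M → LeafChild M x → isInternal G M ≡ true
  leafChild⇒internal sM (x⊂M , _) = ∧-intro (Strong⇒isStrong sM) (not-intro (2≤⇒1≢ᵇ (⁅x⁆⊂⇒∣∣≥2 x⊂M)))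

  labelN⇒nondegenerate : ∀ {M} → labelN G M ≡ true → ¬ Degenerate M
  labelN⇒nondegenerate {M} N (false , P) = true≢false P (not-true (proj₁ (∧-true N)))
  labelN⇒nondegenerate {M} N (true  , S) = true≢false S (not-true (proj₂ (∧-true {not (labelP G M)} N)))

  nondegenerate⇒labelN : ∀ {M} → ¬ Degenerate M → labelN G M ≡ true
  nondegenerate⇒labelN ¬deg =
    ∧-intro (not-intro (Bool.¬-not (¬deg ∘ (false ,_)))) (not-intro (Bool.¬-not (¬deg ∘ (true ,_))))

  labelP∨S⇒degenerate : ∀ {M} → labelP G M ∨ labelS G M ≡ true → Degenerate M
  labelP∨S⇒degenerate P∨S with ∨-true P∨S
  ... | inj₁ P = false , P
  ... | inj₂ S = true , S

  degenerate⇒labelP∨S : ∀ {M} → Degenerate M → labelP G M ∨ labelS G M ≡ true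
  degenerate⇒labelP∨S         (false , P) = ∨-introˡ P
  degenerate⇒labelP∨S {M} (true  , S) = ∨-introʳ {labelP G M} S

  private
    N-part⇒twinClass : ∀ {M A} → Strong M →
      labelN G M ∧ any (λ x → isLeafChild G M x ∧ (A == ⁅ x ⁆)) (vtx n) ≡ true → ∃[ x ] TwinClass A x
    N-part⇒twinClass {M} {A} sM p with ∧-true {labelN G M} p
    ... | N , some-x with Vertices.any-true {n} some-x
    ... | x , q with ∧-true {isLeafChild G M x} q
    ... | lx , A=⁅x⁆ = x , subst (λ B → TwinClass B x) (sym (==⇒≡ A=⁅x⁆))
            (twinless⇒singleton-twinClass (nondegenerate⇒leafChild-twinless sM (labelN⇒nondegenerate N) (isLeafChild⇒LeafChild lx)))

    PS-part⇒twinClass : ∀ {M A} → Strong M →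
      (labelP G M ∨ labelS G M) ∧ nonemptyᵇ A ∧ (A == leafChildren G M) ≡ true → ∃[ x ] TwinClass A x
    PS-part⇒twinClass {M} {A} sM p with ∧-true {labelP G M ∨ labelS G M} p
    ... | P∨S , q with ∧-true {nonemptyᵇ A} q | labelP∨S⇒degenerate P∨S
    ... | A≠∅ , A=L | b , lab with nonemptyᵇ⇒Nonempty {A = A} A≠∅ | ==⇒≡ {A = A} A=L
    ... | x , x∈A | refl = x , labelled-leafChildren-twinClass {b} sM lab (∈⇒leafChild {M} x∈A)

  qPart⇒twinClass : ∀ {A} → isQPart G A ≡ true → ∃[ x ] TwinClass A x
  qPart⇒twinClass p with Subsets.any-true {n} p
  ... | M , q with ∧-true {isInternal G M} q
  ... | internal , part with ∨-true part
  ... | inj₁ N-part  = N-part⇒twinClass {M} (internal⇒strong internal) N-part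
  ... | inj₂ PS-part = PS-part⇒twinClass {M} (internal⇒strong internal) PS-part

  twinClass⇒qPart : ∀ {A x} → 2 ≤ n → TwinClass A x → isQPart G A ≡ true
  twinClass⇒qPart {A} {x} 2≤n cl with leafChild-exists (proj₂ (another-vertex 2≤n x))
  ... | M , sM , lx = Subsets.any-intro {n} M (∧-intro (leafChild⇒internal sM lx) (part (degenerate? M)))
    where
    part : Dec (Degenerate M) →
      (labelN G M ∧ any (λ x → isLeafChild G M x ∧ (A == ⁅ x ⁆)) (vtx n)) ∨
      ((labelP G M ∨ labelS G M) ∧ nonemptyᵇ A ∧ (A == leafChildren G M)) ≡ true
    part (yes deg@(b , lab)) = ∨-introʳ {labelN G M ∧ _}
      (∧-intro (degenerate⇒labelP∨S deg) (∧-intro (Nonempty⇒nonemptyᵇ (x , twinClass-∋ cl))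
        (≡⇒== (twinClasses-meet⇒≡ cl (labelled-leafChildren-twinClass {b} sM lab lx)
                                  (twinClass-∋ cl) (leafChild⇒∈ lx)))))
    part (no ¬deg) = ∨-introˡ (∧-intro (nondegenerate⇒labelN ¬deg) (Vertices.any-intro {n} x
      (∧-intro (LeafChild⇒isLeafChild lx) (≡⇒== (twinClasses-meet⇒≡ cl (twinless⇒singleton-twinClass (nondegenerate⇒leafChild-twinless sM ¬deg lx))
                                                        (twinClass-∋ cl) (x∈⁅x⁆ x))))))

  uVertex⇒twinless : ∀ {A} → isUVertex G A ≡ true → ∃[ x ] (TwinClass A x × Twinless x)
  uVertex⇒twinless {A} p with ∧-true {isQPart G A} p
  ... | qPart , singleton with qPart⇒twinClass qPart
  ... | x , cl = x , cl , twinless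
    where
    twinless : Twinless x
    twinless {y} twin with y ≟ x
    ... | yes y≡x = y≡x
    ... | no  y≢x = ⊥-elim (true≢false singleton
                      (2≤⇒1≢ᵇ (⁅x⁆⊂⇒∣∣≥2 (⁅x⁆⊂ (twinClass-∋ cl) (member cl twin) y≢x))))

  twinless⇒uVertex : ∀ {A x} → 2 ≤ n → TwinClass A x → Twinless x → isUVertex G A ≡ true
  twinless⇒uVertex {A} {x} 2≤n cl twinless with twinClasses-meet⇒≡ cl (twinless⇒singleton-twinClass twinless)
                                                                 (twinClass-∋ cl) (x∈⁅x⁆ x)
  ... | refl = ∧-intro (twinClass⇒qPart 2≤n cl) (cong (1 ≡ᵇ_) (∣⁅x⁆∣≡1 x))

  degenerateVertex : Bool → Subset n → Bool
  degenerateVertex b A = (2 ≤ᵇ ∣ A ∣) ∧ nonemptyᵇ A ∧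
    any (λ M → isInternal G M ∧ labelled b M ∧ (A == leafChildren G M)) (allSubsets n)

  TwinIn : Subset n → Fin n → Bool → Set
  TwinIn A x b = ∃[ y ] (y ∈ A × y ≢ x × E x y ≡ b)

  degenerateVertex⇒twinIn : ∀ b {A} → degenerateVertex b A ≡ true → ∃[ x ] (TwinClass A x × TwinIn A x b)
  degenerateVertex⇒twinIn b {A} p with ∧-true {2 ≤ᵇ ∣ A ∣} p
  ... | big , q with ∧-true {nonemptyᵇ A} q
  ... | A≠∅ , r with Subsets.any-true {n} r | nonemptyᵇ⇒Nonempty {A = A} A≠∅
  ... | M , s | x , x∈A with ∧-true {isInternal G M} s
  ... | internal , t with ∧-true {labelled b M} t
  ... | lab , A=L with ==⇒≡ {A = A} A=L
  ... | refl with ∣∣≥2⇒⁅x⁆⊂ (2≤ᵇ⇒2≤ _ big) x∈A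
  ... | _ , y , y∈A , y∉⁅x⁆ =
    x , labelled-leafChildren-twinClass {b} sM lab lx , y , y∈A , y≢x ,
    labelled-leafChild-adjacency b sM lab lx (⁅x⁆⊂⇒∈ (proj₁ (∈⇒leafChild {M} y∈A))) y≢x
    where
    sM = internal⇒strong internal
    lx = ∈⇒leafChild {M} x∈A
    y≢x = x∉⁅y⁆⇒x≢y y∉⁅x⁆

  twinIn⇒degenerateVertex : ∀ b {A x} → TwinClass A x → TwinIn A x b → degenerateVertex b A ≡ true
  twinIn⇒degenerateVertex b {A} {x} cl (y , y∈A , y≢x , E-xy) with leafChild-exists y≢x
  ... | M , sM , lx =
    ∧-intro (2≤⇒2≤ᵇ (⁅x⁆⊂⇒∣∣≥2 (⁅x⁆⊂ (twinClass-∋ cl) y∈A y≢x)))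
      (∧-intro (Nonempty⇒nonemptyᵇ (x , twinClass-∋ cl))
        (Subsets.any-intro {n} M (∧-intro (leafChild⇒internal sM lx) (∧-intro lab (≡⇒== A≡L)))))
    where
    y∈M : y ∈ M
    y∈M = ⁅x⁆⊂⇒∈ (proj₁ (twin-leafChild sM lx (twin-of cl y∈A) y≢x))
    labelled-by-adjacency : Degenerate M → labelled b M ≡ true
    labelled-by-adjacency (b′ , lab′) =
      subst (λ c → labelled c M ≡ true) (trans (sym (labelled-leafChild-adjacency b′ sM lab′ lx y∈M y≢x)) E-xy) lab′
    lab : labelled b M ≡ true
    lab = labelled-by-adjacency (twin⇒degenerate sM lx (twin-of cl y∈A) y≢x)
    A≡L : A ≡ leafChildren G M
    A≡L = twinClasses-meet⇒≡ cl (labelled-leafChildren-twinClass {b} sM lab lx) (twinClass-∋ cl) (leafChild⇒∈ lx)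

module OneEdit {n} (2≤n : 2 ≤ n) (G : Graph n) (u v : Fin n) (u≢v : u ≢ v) where

  H : Graph n
  H = edit1 G u v u≢v

  module OfG = TwinClasses G
  module OfH = TwinClasses H
  open OfG using (Twin; E)

  twin? : ∀ x y → Dec (Twin x y)
  twin? x y = all? λ z → ¬? (z ≟ x) →-dec ¬? (z ≟ y) →-dec (E x z Bool.≟ E y z)

  twinClosure : Subset n → Subset n
  twinClosure A = tabulate λ y → ⌊ any? (λ x → x ∈? A ×-dec twin? x y) ⌋

  ∈twinClosure⁻ : ∀ {A y} → y ∈ twinClosure A → ∃[ x ] (x ∈ A × Twin x y)
  ∈twinClosure⁻ {A} {y} y∈ = does-true (any? (λ x → x ∈? A ×-dec twin? x y))
    (trans (sym (lookup∘tabulate _ y)) (∈⇒∋ y∈))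

  ∈twinClosure⁺ : ∀ {A x y} → x ∈ A → Twin x y → y ∈ twinClosure A
  ∈twinClosure⁺ {A} {x} {y} x∈A twin = ∋⇒∈ (trans (lookup∘tabulate _ y)
    (does-intro (any? (λ x → x ∈? A ×-dec twin? x y)) (x , x∈A , twin)))

  Away : Fin n → Set
  Away x = x ≢ u × x ≢ v

  Avoids : Subset n → Set
  Avoids A = u ∉ A × v ∉ A

  avoids⇒away : ∀ {A x} → Avoids A → x ∈ A → Away x
  avoids⇒away (u∉A , v∉A) x∈A = (λ { refl → u∉A x∈A }) , (λ { refl → v∉A x∈A })

  edit-away : ∀ {x} y → Away x → adj H x y ≡ adj G x y
  edit-away {x} y (x≢u , x≢v) rewrite does-false (x ≟ u) x≢u | does-false (x ≟ v) x≢v = refl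

  twin-G⇒H : ∀ {x y} → Away x → Away y → Twin x y → OfH.Twin x y
  twin-G⇒H {x} {y} x-away y-away twin z z≢x z≢y =
    trans (edit-away z x-away) (trans (twin z z≢x z≢y) (sym (edit-away z y-away)))

  twin-H⇒G : ∀ {x y} → Away x → Away y → OfH.Twin x y → Twin x y
  twin-H⇒G {x} {y} x-away y-away twin z z≢x z≢y =
    trans (sym (edit-away z x-away)) (trans (twin z z≢x z≢y) (edit-away z y-away))

  avoiding-twinClass⇒closure-twinClass : ∀ {A x} → Avoids A → OfH.TwinClass A x →
    OfG.TwinClass (twinClosure A) x
  avoiding-twinClass⇒closure-twinClass {A} {x} avoids cl = record
    { twin-of = λ y∈ → let (x′ , x′∈A , x′-y) = ∈twinClosure⁻ y∈ in
        OfG.twin-trans (twin-H⇒G (away x∈A) (away x′∈A) (OfH.twin-of cl x′∈A)) x′-y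
    ; member  = ∈twinClosure⁺ x∈A
    }
    where
    away : ∀ {y} → y ∈ A → Away y
    away = avoids⇒away avoids
    x∈A : x ∈ A
    x∈A = OfH.twinClass-∋ cl

  avoiding-twinClasses⇒closure-injective : ∀ {A B x y} → Avoids A → Avoids B →
    OfH.TwinClass A x → OfH.TwinClass B y → twinClosure A ≡ twinClosure B → A ≡ B
  avoiding-twinClasses⇒closure-injective {A} {B} {x} {y} avA avB clA clB closures≡ =
    OfH.twinClasses-meet⇒≡ clA clB x∈A
      (OfH.member clB (twin-G⇒H (avoids⇒away avB y∈B) (avoids⇒away avA x∈A) y-x))
    where
    x∈A : x ∈ A
    x∈A = OfH.twinClass-∋ clA
    y∈B : y ∈ B
    y∈B = OfH.twinClass-∋ clB
    y-x : Twin y x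
    y-x = OfG.twin-of (avoiding-twinClass⇒closure-twinClass avB clB)
            (subst (x ∈_) closures≡ (OfG.twinClass-∋ (avoiding-twinClass⇒closure-twinClass avA clA)))

  open Counting {Subset n} (≡-dec Bool._≟_)

  avoiding : (Subset n → Bool) → Subset n → Bool
  avoiding p A = (p A ∧ not (A ∋ u)) ∧ not (A ∋ v)

  avoiding⇒avoids : ∀ {p A} → avoiding p A ≡ true → p A ≡ true × Avoids A
  avoiding⇒avoids {p} {A} q with ∧-true {p A ∧ not (A ∋ u)} q
  ... | r , A∌v with ∧-true {p A} r
  ... | pA , A∌u = pA , ∋⇒∉ (not-true A∌u) , ∋⇒∉ (not-true A∌v)

  HClasses : (Subset n → Bool) → Set
  HClasses p = ∀ {A} → p A ≡ true → ∃[ x ] OfH.TwinClass A x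

  classes-through-≤1 : ∀ p → HClasses p → ∀ w → countSubsets n (λ A → p A ∧ A ∋ w) ≤ 1
  classes-through-≤1 p classes w = count-≤1 (λ A → p A ∧ A ∋ w) (allSubsets-unique n) λ {A} {B} q r →
    OfH.twinClasses-meet⇒≡ (proj₂ (classes (proj₁ (∧-true {p A} q)))) (proj₂ (classes (proj₁ (∧-true {p B} r))))
                           (∋⇒∈ (proj₂ (∧-true {p A} q))) (∋⇒∈ (proj₂ (∧-true {p B} r)))

  all-but-two-avoid : ∀ p → HClasses p → countSubsets n p ≤ 2 + countSubsets n (avoiding p)
  all-but-two-avoid p classes =
    ≤-trans (count-split p (_∋ u) (allSubsets n))
      (+-mono-≤ (classes-through-≤1 p classes u)
        (≤-trans (count-split (λ A → p A ∧ not (A ∋ u)) (_∋ v) (allSubsets n))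
          (+-mono-≤ (classes-through-≤1 _ (λ {A} → classes ∘ proj₁ ∘ ∧-true {p A}) v) ≤-refl)))

  edit-bound : ∀ pH pG → HClasses pH → (∀ {A} → Avoids A → pH A ≡ true → pG (twinClosure A) ≡ true) →
    countSubsets n pH ≤ 2 + countSubsets n pG
  edit-bound pH pG classes preserved =
    ≤-trans (all-but-two-avoid pH classes) (+-monoʳ-≤ 2
      (count-injective twinClosure (avoiding pH) pG (allSubsets-unique n) allSubsets-complete
        (λ q → let (pA , avA) = avoiding⇒avoids {pH} q in preserved avA pA)
        (λ q r → let (pA , avA) = avoiding⇒avoids {pH} q ; (pB , avB) = avoiding⇒avoids {pH} r in
                 avoiding-twinClasses⇒closure-injective avA avB (proj₂ (classes pA)) (proj₂ (classes pB)))))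

  qPart-bound : numV H ≤ 2 + numV G
  qPart-bound = edit-bound (isQPart H) (isQPart G) OfH.qPart⇒twinClass λ avA pA →
    OfG.twinClass⇒qPart 2≤n (avoiding-twinClass⇒closure-twinClass avA (proj₂ (OfH.qPart⇒twinClass pA)))

  degenerateVertex-bound : ∀ b → countSubsets n (OfH.degenerateVertex b) ≤ 2 + countSubsets n (OfG.degenerateVertex b)
  degenerateVertex-bound b = edit-bound (OfH.degenerateVertex b) (OfG.degenerateVertex b)
    (λ pA → let (x , cl , _) = OfH.degenerateVertex⇒twinIn b pA in x , cl) preserved
    where
    preserved : ∀ {A} → Avoids A → OfH.degenerateVertex b A ≡ true → OfG.degenerateVertex b (twinClosure A) ≡ true
    preserved avA pA with OfH.degenerateVertex⇒twinIn b pA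
    ... | x , cl , y , y∈A , y≢x , E-xy =
      OfG.twinIn⇒degenerateVertex b (avoiding-twinClass⇒closure-twinClass avA cl)
        (y , ∈twinClosure⁺ y∈A OfG.twin-refl , y≢x ,
         trans (sym (edit-away y (avoids⇒away avA (OfH.twinClass-∋ cl)))) E-xy)

  pVertex-bound : numP H ≤ 2 + numP G
  pVertex-bound = degenerateVertex-bound false

  sVertex-bound : numS H ≤ 2 + numS G
  sVertex-bound = degenerateVertex-bound true

  avoiding-classes-sharing-twin : ∀ {A B x y w} → Avoids A → Avoids B → OfH.TwinClass A x → OfH.TwinClass B y →
    w ∈ twinClosure A → w ∈ twinClosure B → A ≡ B
  avoiding-classes-sharing-twin avA avB clA clB w∈A′ w∈B′
    with ∈twinClosure⁻ w∈A′ | ∈twinClosure⁻ w∈B′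
  ... | a , a∈A , a-w | b , b∈B , b-w =
    OfH.twinClasses-meet⇒≡ clA clB a∈A
      (OfH.member clB (OfH.twin-trans (OfH.twin-of clB b∈B)
        (twin-G⇒H (avoids⇒away avB b∈B) (avoids⇒away avA a∈A) (OfG.twin-trans b-w (OfG.twin-sym a-w)))))

  twinless-in-H⇒twin-of-edited : ∀ {A x} → Avoids A → OfH.TwinClass A x → OfH.Twinless x →
    isUVertex G A ≡ false → u ∉ twinClosure A → v ∈ twinClosure A
  twinless-in-H⇒twin-of-edited {A} {x} avA cl twinlessᴴ ¬U u∉A′
    with any? (λ y → ¬? (y ≟ x) ×-dec twin? x y)
  ... | yes (y , y≢x , x-y) with y ≟ u | y ≟ v
  ...   | yes refl | _        = contradiction (∈twinClosure⁺ (OfH.twinClass-∋ cl) x-y) u∉A′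
  ...   | no  _    | yes refl = ∈twinClosure⁺ (OfH.twinClass-∋ cl) x-y
  ...   | no  y≢u  | no  y≢v  =
    contradiction (twinlessᴴ (twin-G⇒H (avoids⇒away avA (OfH.twinClass-∋ cl)) (y≢u , y≢v) x-y)) y≢x
  twinless-in-H⇒twin-of-edited {A} {x} avA cl twinlessᴴ ¬U u∉A′
      | no no-twin = ⊥-elim (true≢false (OfG.twinless⇒uVertex 2≤n clᴳ twinlessᴳ) ¬U)
    where
    twinlessᴳ : OfG.Twinless x
    twinlessᴳ {y} x-y with y ≟ x
    ... | yes y≡x = y≡x
    ... | no  y≢x = contradiction (y , y≢x , x-y) no-twin
    clᴳ : OfG.TwinClass A x
    clᴳ = subst (λ B → OfG.TwinClass B x)
            (sym (OfH.twinClasses-meet⇒≡ cl (OfH.twinless⇒singleton-twinClass twinlessᴴ) (OfH.twinClass-∋ cl) (x∈⁅x⁆ x)))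
            (OfG.twinless⇒singleton-twinClass twinlessᴳ)

  sharing-twin-≤1 : ∀ q w → (∀ {A} → q A ≡ true → Avoids A × ∃[ x ] OfH.TwinClass A x) →
    (∀ {A} → q A ≡ true → w ∈ twinClosure A) → countSubsets n q ≤ 1
  sharing-twin-≤1 q w classes shares = count-≤1 q (allSubsets-unique n) λ qA qB →
    let (avA , _ , clA) = classes qA ; (avB , _ , clB) = classes qB
    in avoiding-classes-sharing-twin avA avB clA clB (shares qA) (shares qB)

  -- A singleton class of H avoiding u and v is a singleton class of G, unless its vertex is a G-twin
  -- of u or of v; each of these two cases concerns at most one class.
  uVertex-bound : numU H ≤ 2 + (numU G + 2)
  uVertex-bound =
    ≤-trans (all-but-two-avoid (isUVertex H) U-classes) (+-monoʳ-≤ 2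
      (≤-trans (count-split (avoiding (isUVertex H)) (isUVertex G) (allSubsets n))
        (+-mono-≤ still-U
          (≤-trans (count-split lost-U (λ A → twinClosure A ∋ u) (allSubsets n))
            (+-mono-≤ (sharing-twin-≤1 _ u (lost-U-classes ∘ proj₁ ∘ ∧-true) (∋⇒∈ ∘ proj₂ ∘ ∧-true))
                      (sharing-twin-≤1 _ v (lost-U-classes ∘ proj₁ ∘ ∧-true) twin-of-v))))))
    where
    U-classes : HClasses (isUVertex H)
    U-classes pA = let (x , cl , _) = OfH.uVertex⇒twinless pA in x , cl
    still-U : countSubsets n (λ A → avoiding (isUVertex H) A ∧ isUVertex G A) ≤ numU G
    still-U = count-injective (λ A → A) _ (isUVertex G) (allSubsets-unique n) allSubsets-complete
                (λ {A} → proj₂ ∘ ∧-true {avoiding (isUVertex H) A}) (λ _ _ A≡B → A≡B)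
    lost-U : Subset n → Bool
    lost-U A = avoiding (isUVertex H) A ∧ not (isUVertex G A)
    lost-U-data : ∀ {A} → lost-U A ≡ true →
      Avoids A × isUVertex G A ≡ false × ∃[ x ] (OfH.TwinClass A x × OfH.Twinless x)
    lost-U-data q with ∧-true q
    ... | r , notU with avoiding⇒avoids {isUVertex H} r
    ... | U , avA = avA , not-true notU , OfH.uVertex⇒twinless U
    lost-U-classes : ∀ {A} → lost-U A ≡ true → Avoids A × ∃[ x ] OfH.TwinClass A x
    lost-U-classes q = let (avA , _ , x , cl , _) = lost-U-data q in avA , x , cl
    twin-of-v : ∀ {A} → lost-U A ∧ not (twinClosure A ∋ u) ≡ true → v ∈ twinClosure A
    twin-of-v q with ∧-true q
    ... | r , u∉ = let (avA , notU , x , cl , twinless) = lost-U-data r in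
      twinless-in-H⇒twin-of-edited avA cl twinless notU (∋⇒∉ (not-true u∉))

lemma5 : (n : ℕ) → 2 ≤ n → (G : Graph n) → (u v : Fin n) → (u≢v : u ≢ v) →
    (numU (edit1 G u v u≢v) ≤ numU G + 4) ×
    (numP (edit1 G u v u≢v) ≤ numP G + 2) ×
    (numS (edit1 G u v u≢v) ≤ numS G + 2) ×
    (numV (edit1 G u v u≢v) ≤ numV G + 2)
lemma5 n 2≤n G u v u≢v =
  subst (numU H ≤_) (trans (+-comm 2 (numU G + 2)) (+-assoc (numU G) 2 2)) uVertex-bound ,
  subst (numP H ≤_) (+-comm 2 (numP G)) pVertex-bound ,
  subst (numS H ≤_) (+-comm 2 (numS G)) sVertex-bound ,
  subst (numV H ≤_) (+-comm 2 (numV G)) qPart-bound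
  where
  open OneEdit 2≤n G u v u≢v
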